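{- Let $m\geq 1$ and consider $\Delta_m\subseteq\mathrm{Hex}_m$. If $S\subseteq\Delta_m$ is a subgraph isomorphic to $\Delta_{m-1}$, then either (1) $S$ is the image of the map $\Delta_{m-1}\to\mathrm{Hex}_m$, $a\mapsto a+e$, for some $e\in\{(1,0,0),(0,1,0),(0,0,1)\}$, or (2) $m=2$ and $S$ is the triangle $\nabla_1$ on the vertices $(1,1,0),(0,1,1),(1,0,1)$. In particular, $\Delta_m$ is contained in the closed neighbourhood of $S$ in $\mathrm{Hex}_m$.
   Context: $\mathrm{Hex}_m$ is the graph with vertex set $\{x\in\mathbb Z^3:x_1+x_2+x_3=m\}$, where $x,y$ are adjacent iff $x-y\in\{(1,-1,0),(1,0,-1),(-1,1,0),(0,1,-1),(-1,0,1),(0,-1,1)\}$; $\Delta_m$ is its subgraph induced by the vertices with nonnegative coordinates. The closed neighbourhood of a subgraph $S$ is the subgraph induced by the vertices of $S$ and all vertices adjacent to some vertex of $S$. -}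

module Defs where

open import Data.Nat using (ℕ)
open import Data.Integer using (ℤ; +_; _+_; _-_; _≤_; 0ℤ; -1ℤ; 1ℤ)
open import Data.List using (List; _∷_; [])
open import Data.List.Membership.Propositional using (_∈_)
open import Data.Product using (Σ; _×_; ∃)
open import Data.Sum using (_⊎_)
open import Relation.Binary.PropositionalEquality using (_≡_)

record ℤ³ : Set where
  constructor ⟨_,_,_⟩
  field
    x₁ x₂ x₃ : ℤ
open ℤ³ public

_⊕_ : ℤ³ → ℤ³ → ℤ³
⟨ a , b , c ⟩ ⊕ ⟨ d , e , f ⟩ = ⟨ a + d , b + e , c + f ⟩

_⊖_ : ℤ³ → ℤ³ → ℤ³
⟨ a , b , c ⟩ ⊖ ⟨ d , e , f ⟩ = ⟨ a - d , b - e , c - f ⟩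

directions : List ℤ³
directions =
  ⟨ 1ℤ , -1ℤ , 0ℤ ⟩ ∷ ⟨ 1ℤ , 0ℤ , -1ℤ ⟩ ∷ ⟨ -1ℤ , 1ℤ , 0ℤ ⟩ ∷
  ⟨ 0ℤ , 1ℤ , -1ℤ ⟩ ∷ ⟨ -1ℤ , 0ℤ , 1ℤ ⟩ ∷ ⟨ 0ℤ , -1ℤ , 1ℤ ⟩ ∷ []

HexAdj : ℤ³ → ℤ³ → Set
HexAdj x y = (x ⊖ y) ∈ directions

HexV : ℕ → Set
HexV m = Σ ℤ³ (λ x → x₁ x + x₂ x + x₃ x ≡ + m)

-- Vertices of Δ_m: vertices of Hex_m with nonnegative coordinates.
-- Δ_m is the induced subgraph, so its adjacency is HexAdj on points.
ΔV : ℕ → Set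
ΔV m = Σ (HexV m) (λ v → (0ℤ ≤ x₁ (Σ.proj₁ v)) × (0ℤ ≤ x₂ (Σ.proj₁ v)) × (0ℤ ≤ x₃ (Σ.proj₁ v)))

pt : ∀ {m} → ΔV m → ℤ³
pt v = Σ.proj₁ (Σ.proj₁ v)

record Subgraph (m : ℕ) : Set₁ where
  field
    V     : ΔV m → Set
    E     : ΔV m → ΔV m → Set
    E-sub : ∀ u v → E u v → V u × V v × HexAdj (pt u) (pt v)
    E-sym : ∀ u v → E u v → E v u
open Subgraph public

record IsoFromΔ (n : ℕ) {m : ℕ} (S : Subgraph m) : Set where
  field
    φ      : ΔV n → ΔV m
    inj    : ∀ a b → pt (φ a) ≡ pt (φ b) → pt a ≡ pt b
    onto   : ∀ v → V S v → ∃ (λ a → pt (φ a) ≡ pt v)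
    into   : ∀ a → V S (φ a)
    edges  : ∀ a b → (HexAdj (pt a) (pt b) → E S (φ a) (φ b)) × (E S (φ a) (φ b) → HexAdj (pt a) (pt b))

_⇔_ : Set → Set → Set
A ⇔ B = (A → B) × (B → A)

units : List ℤ³
units = ⟨ 1ℤ , 0ℤ , 0ℤ ⟩ ∷ ⟨ 0ℤ , 1ℤ , 0ℤ ⟩ ∷ ⟨ 0ℤ , 0ℤ , 1ℤ ⟩ ∷ []

nabla₁ : List ℤ³
nabla₁ = ⟨ 1ℤ , 1ℤ , 0ℤ ⟩ ∷ ⟨ 0ℤ , 1ℤ , 1ℤ ⟩ ∷ ⟨ 1ℤ , 0ℤ , 1ℤ ⟩ ∷ []

IsTranslate : ∀ n {m} → Subgraph m → ℤ³ → Set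
IsTranslate n S e =
  (∀ v → V S v ⇔ ∃ (λ (a : ΔV n) → pt a ⊕ e ≡ pt v)) ×
  (∀ u v → E S u v ⇔ Σ (ΔV n) (λ a → Σ (ΔV n) (λ b →
      HexAdj (pt a) (pt b) × (pt a ⊕ e ≡ pt u) × (pt b ⊕ e ≡ pt v))))

IsNabla₁ : ∀ {m} → Subgraph m → Set
IsNabla₁ S =
  (∀ v → V S v ⇔ (pt v ∈ nabla₁)) ×
  (∀ u v → E S u v ⇔ ((pt u ∈ nabla₁) × (pt v ∈ nabla₁) × HexAdj (pt u) (pt v)))

InClosedNbhd : ∀ {m} → Subgraph m → Set
InClosedNbhd {m} S = ∀ (v : ΔV m) → Σ (ΔV m) (λ u → V S u × ((pt u ≡ pt v) ⊎ HexAdj (pt u) (pt v)))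

-- An injective, adjacency-preserving map F from Δ_n (n ≥ 1) into Hex is affine. In Hex, distinct
-- common neighbours z, w of adjacent x, y satisfy w + z = x + y, and every vertex of Δ_n is reached
-- from the apex triangle by successively completing such rhombi, so F agrees with every affine map
-- that agrees with it on the apex triangle. The image of that triangle is a unit triangle of Hex,
-- hence a translate of the apex triangle moved by one of the twelve lattice symmetries ±σ
-- (σ a coordinate permutation), and so F a = T ± σ a. If F lands in Δ_{n+1}, nonnegativity and the
-- coordinate sum at the corners of Δ_n make T a unit vector in the + case, while in the − case
-- σ⁻¹ T − n (1,1,1) is nonnegative with coordinate sum 1 − n, forcing n = 1 and T = (1,1,1).

module Submission where

open import Defs
open import Data.Nat as ℕ using (ℕ; zero; suc; z≤n; s≤s)
import Data.Nat.Properties as ℕ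
import Data.Nat.Tactic.RingSolver as ℕ-Solver
open import Data.Integer as ℤ using (ℤ; +_; _+_; _-_; -_; 0ℤ; 1ℤ; -1ℤ; +≤+)
import Data.Integer.Properties as ℤ
open import Data.Integer.Tactic.RingSolver using (solve-∀)
open import Algebra.Properties.AbelianGroup ℤ.+-0-abelianGroup using (∙-cancelʳ)
open import Data.List using (List; _∷_; []; cartesianProduct)
open import Data.List.Membership.Propositional using (_∈_)
import Data.List.Membership.DecPropositional as DecMembership
open import Data.List.Relation.Unary.All as All using (All; all?)
open import Data.List.Relation.Unary.Any as Any using (Any; here; there)
open import Data.Product using (Σ; ∃; _×_; _,_; proj₁; proj₂)
open import Data.Sum as Sum using (_⊎_; inj₁; inj₂)
open import Function using (_∘_)
open import Relation.Nullary using (¬_; yes; no)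
open import Relation.Nullary.Decidable using (True; toWitness; toWitnessFalse; _×-dec_; _→-dec_; ¬?)
open import Relation.Binary.Definitions using (DecidableEquality)
open import Relation.Binary.PropositionalEquality
import Axiom.UniquenessOfIdentityProofs as UIP

ℤ³-ext : ∀ {a b : ℤ³} → x₁ a ≡ x₁ b → x₂ a ≡ x₂ b → x₃ a ≡ x₃ b → a ≡ b
ℤ³-ext refl refl refl = refl

infix 4 _≟³_
_≟³_ : DecidableEquality ℤ³
⟨ a , b , c ⟩ ≟³ ⟨ d , e , f ⟩ with a ℤ.≟ d | b ℤ.≟ e | c ℤ.≟ f
... | yes refl | yes refl | yes refl = yes refl
... | no a≢d   | _        | _        = no λ { refl → a≢d refl }
... | yes _    | no b≢e   | _        = no λ { refl → b≢e refl }
... | yes _    | yes _    | no c≢f   = no λ { refl → c≢f refl }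

open DecMembership _≟³_ using (_∈?_)

neg : ℤ³ → ℤ³
neg v = ⟨ - x₁ v , - x₂ v , - x₃ v ⟩

coordSum : ℤ³ → ℤ
coordSum v = x₁ v + x₂ v + x₃ v

Nonneg : ℤ³ → Set
Nonneg v = (0ℤ ℤ.≤ x₁ v) × (0ℤ ℤ.≤ x₂ v) × (0ℤ ℤ.≤ x₃ v)

c111 : ℤ³
c111 = ⟨ 1ℤ , 1ℤ , 1ℤ ⟩

⊕-comm : ∀ a b → a ⊕ b ≡ b ⊕ a
⊕-comm a b = ℤ³-ext (ℤ.+-comm (x₁ a) (x₁ b)) (ℤ.+-comm (x₂ a) (x₂ b)) (ℤ.+-comm (x₃ a) (x₃ b))

⊕-interchange : ∀ a b c d → (a ⊕ b) ⊕ (c ⊕ d) ≡ (a ⊕ c) ⊕ (b ⊕ d)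
⊕-interchange a b c d =
  ℤ³-ext (lemma (x₁ a) (x₁ b) (x₁ c) (x₁ d))
         (lemma (x₂ a) (x₂ b) (x₂ c) (x₂ d))
         (lemma (x₃ a) (x₃ b) (x₃ c) (x₃ d))
  where lemma : ∀ x y z w → (x + y) + (z + w) ≡ (x + z) + (y + w)
        lemma = solve-∀

⊕-cancelʳ : ∀ a b c → a ⊕ c ≡ b ⊕ c → a ≡ b
⊕-cancelʳ a b c eq =
  ℤ³-ext (∙-cancelʳ (x₁ c) _ _ (cong x₁ eq))
         (∙-cancelʳ (x₂ c) _ _ (cong x₂ eq))
         (∙-cancelʳ (x₃ c) _ _ (cong x₃ eq))

⊕-neg-cancel : ∀ a b → a ≡ (a ⊕ neg b) ⊕ b
⊕-neg-cancel a b = ℤ³-ext (lemma (x₁ a) (x₁ b)) (lemma (x₂ a) (x₂ b)) (lemma (x₃ a) (x₃ b))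
  where lemma : ∀ x y → x ≡ (x + - y) + y
        lemma = solve-∀

⊕-identityʳ : ∀ a → a ⊕ ⟨ 0ℤ , 0ℤ , 0ℤ ⟩ ≡ a
⊕-identityʳ a = ℤ³-ext (ℤ.+-identityʳ (x₁ a)) (ℤ.+-identityʳ (x₂ a)) (ℤ.+-identityʳ (x₃ a))

⊖-⊕-cancel : ∀ a b → a ≡ (a ⊖ b) ⊕ b
⊖-⊕-cancel a b = ℤ³-ext (lemma (x₁ a) (x₁ b)) (lemma (x₂ a) (x₂ b)) (lemma (x₃ a) (x₃ b))
  where lemma : ∀ x y → x ≡ (x - y) + y
        lemma = solve-∀

[a⊖b]⊕[[c⊖a]⊕b]≡c : ∀ a b c → (a ⊖ b) ⊕ ((c ⊖ a) ⊕ b) ≡ c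
[a⊖b]⊕[[c⊖a]⊕b]≡c a b c =
  ℤ³-ext (lemma (x₁ a) (x₁ b) (x₁ c)) (lemma (x₂ a) (x₂ b) (x₂ c)) (lemma (x₃ a) (x₃ b) (x₃ c))
  where lemma : ∀ x y z → (x - y) + ((z - x) + y) ≡ z
        lemma = solve-∀

[a⊖c]⊖[b⊖c]≡a⊖b : ∀ a b c → (a ⊖ c) ⊖ (b ⊖ c) ≡ a ⊖ b
[a⊖c]⊖[b⊖c]≡a⊖b a b c =
  ℤ³-ext (lemma (x₁ a) (x₁ b) (x₁ c)) (lemma (x₂ a) (x₂ b) (x₂ c)) (lemma (x₃ a) (x₃ b) (x₃ c))
  where lemma : ∀ x y z → (x - z) - (y - z) ≡ x - y
        lemma = solve-∀

[d⊕a]⊖a≡d : ∀ d a → (d ⊕ a) ⊖ a ≡ d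
[d⊕a]⊖a≡d d a = ℤ³-ext (lemma (x₁ d) (x₁ a)) (lemma (x₂ d) (x₂ a)) (lemma (x₃ d) (x₃ a))
  where lemma : ∀ x y → (x + y) - y ≡ x
        lemma = solve-∀

neg-⊕ : ∀ a b → neg (a ⊕ b) ≡ neg a ⊕ neg b
neg-⊕ a b = ℤ³-ext (lemma (x₁ a) (x₁ b)) (lemma (x₂ a) (x₂ b)) (lemma (x₃ a) (x₃ b))
  where lemma : ∀ x y → - (x + y) ≡ - x + - y
        lemma = solve-∀

coordSum-⊕ : ∀ a b → coordSum (a ⊕ b) ≡ coordSum a + coordSum b
coordSum-⊕ a b = lemma (x₁ a) (x₂ a) (x₃ a) (x₁ b) (x₂ b) (x₃ b)
  where lemma : ∀ a₁ a₂ a₃ b₁ b₂ b₃ →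
                (a₁ + b₁) + (a₂ + b₂) + (a₃ + b₃) ≡ (a₁ + a₂ + a₃) + (b₁ + b₂ + b₃)
        lemma = solve-∀

toΔ : ∀ {m} (v : ℤ³) → Nonneg v → coordSum v ≡ + m → ΔV m
toΔ v nonneg sum = (v , sum) , nonneg

Δ-nonneg : ∀ {m} (a : ΔV m) → Nonneg (pt a)
Δ-nonneg = proj₂

Δ-sum : ∀ {m} (a : ΔV m) → coordSum (pt a) ≡ + m
Δ-sum a = proj₂ (proj₁ a)

pt-injective : ∀ {m} {a b : ΔV m} → pt a ≡ pt b → a ≡ b
pt-injective {a = (p , s) , (q₁ , q₂ , q₃)} {(.p , s′) , (r₁ , r₂ , r₃)} refl
  rewrite UIP.Decidable⇒UIP.≡-irrelevant ℤ._≟_ s s′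
        | ℤ.≤-irrelevant q₁ r₁ | ℤ.≤-irrelevant q₂ r₂ | ℤ.≤-irrelevant q₃ r₃ = refl

vertex : ∀ {m} i j k → i ℕ.+ j ℕ.+ k ≡ m → ΔV m
vertex i j k e = toΔ ⟨ + i , + j , + k ⟩ (+≤+ z≤n , +≤+ z≤n , +≤+ z≤n) (cong +_ e)

data Coordinates {m} : ΔV m → Set where
  coordinates : ∀ i j k (e : i ℕ.+ j ℕ.+ k ≡ m) → Coordinates (vertex i j k e)

coordinatesOf : ∀ {m} (a : ΔV m) → Coordinates a
coordinatesOf a@((⟨ + i , + j , + k ⟩ , sum) , _)
  rewrite pt-injective {a = a} {vertex i j k (ℤ.+-injective sum)} refl =
  coordinates i j k (ℤ.+-injective sum)

shift₁₂ : ∀ i j k → i ℕ.+ suc j ℕ.+ k ≡ suc i ℕ.+ j ℕ.+ k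
shift₁₂ = ℕ-Solver.solve-∀

shift₁₃ : ∀ i j k → i ℕ.+ j ℕ.+ suc k ≡ suc i ℕ.+ j ℕ.+ k
shift₁₃ = ℕ-Solver.solve-∀

shift₂₃ : ∀ i j k → i ℕ.+ j ℕ.+ suc k ≡ i ℕ.+ suc j ℕ.+ k
shift₂₃ = ℕ-Solver.solve-∀

apex apexNbr₁ apexNbr₂ : ∀ {n} → ΔV (suc n)
apex     {n} = vertex 0 0 (suc n) refl
apexNbr₁ {n} = vertex 1 0 n refl
apexNbr₂ {n} = vertex 0 1 n refl

corner₁ corner₂ corner₃ : ∀ {n} → ΔV n
corner₁ {n} = vertex n 0 0 (trans (ℕ.+-identityʳ (n ℕ.+ 0)) (ℕ.+-identityʳ n))
corner₂ {n} = vertex 0 n 0 (ℕ.+-identityʳ n)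
corner₃ {n} = vertex 0 0 n refl

Δ₁-units : (a : ΔV 1) → pt a ∈ units
Δ₁-units a with coordinatesOf a
... | coordinates 1 0 _ refl = here refl
... | coordinates 0 1 _ refl = there (here refl)
... | coordinates 0 0 _ refl = there (there (here refl))
... | coordinates 0 (suc (suc _)) _ ()
... | coordinates 1 (suc _) _ ()
... | coordinates (suc (suc _)) _ _ ()

along : (d p : ℤ³) {_ : True (d ∈? directions)} → HexAdj (d ⊕ p) p
along d p {d∈} = subst (_∈ directions) (sym ([d⊕a]⊖a≡d d p)) (toWitness d∈)

¬HexAdj-refl : ∀ x → ¬ HexAdj x x
¬HexAdj-refl x x~x = toWitnessFalse {a? = ⟨ 0ℤ , 0ℤ , 0ℤ ⟩ ∈? directions} _
  (subst (_∈ directions) (ℤ³-ext (ℤ.+-inverseʳ (x₁ x)) (ℤ.+-inverseʳ (x₂ x)) (ℤ.+-inverseʳ (x₃ x))) x~x)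

record Rhombus (x y z w : ℤ³) : Set where
  field
    x~y : HexAdj x y
    z~x : HexAdj z x
    z~y : HexAdj z y
    w~x : HexAdj w x
    w~y : HexAdj w y
    z≢w : z ≢ w

private
  rhombus-directions : All (λ d₀ → All (λ d₁ → All (λ d₂ →
    d₁ ⊖ d₀ ∈ directions → d₂ ⊖ d₀ ∈ directions → d₁ ≢ d₂ → d₂ ⊕ d₁ ≡ d₀) directions) directions) directions
  rhombus-directions = toWitness {a? = all? (λ d₀ → all? (λ d₁ → all? (λ d₂ →
    (d₁ ⊖ d₀ ∈? directions) →-dec (d₂ ⊖ d₀ ∈? directions) →-dec ¬? (d₁ ≟³ d₂) →-dec (d₂ ⊕ d₁ ≟³ d₀))
    directions) directions) directions} _

rhombus-parallelogram : ∀ {x y z w} → Rhombus x y z w → w ⊕ z ≡ x ⊕ y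
rhombus-parallelogram {x} {y} {z} {w} r = ℤ³-ext
  (lemma (x₁ w) (x₁ z) (x₁ x) (x₁ y) (cong x₁ relative))
  (lemma (x₂ w) (x₂ z) (x₂ x) (x₂ y) (cong x₂ relative))
  (lemma (x₃ w) (x₃ z) (x₃ x) (x₃ y) (cong x₃ relative))
  where
  open Rhombus r
  relative : (w ⊖ y) ⊕ (z ⊖ y) ≡ x ⊖ y
  relative = All.lookup (All.lookup (All.lookup rhombus-directions x~y) z~y) w~y
    (subst (_∈ directions) (sym ([a⊖c]⊖[b⊖c]≡a⊖b z x y)) z~x)
    (subst (_∈ directions) (sym ([a⊖c]⊖[b⊖c]≡a⊖b w x y)) w~x)
    (λ eq → z≢w (⊕-cancelʳ z w (neg y) eq))
  lemma : ∀ w z x y → (w - y) + (z - y) ≡ x - y → w + z ≡ x + y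
  lemma w z x y eq = begin
    w + z                         ≡⟨ regroup w z y ⟩
    ((w - y) + (z - y)) + (y + y) ≡⟨ cong (_+ (y + y)) eq ⟩
    (x - y) + (y + y)             ≡⟨ unshift x y ⟩
    x + y                         ∎
    where
    open ≡-Reasoning
    regroup : ∀ w z y → w + z ≡ ((w - y) + (z - y)) + (y + y)
    regroup = solve-∀
    unshift : ∀ x y → (x - y) + (y + y) ≡ x + y
    unshift = solve-∀

-- Linear symmetries of the lattice: coordinate permutations, composed with v ↦ -v when inverted

data Perm : Set where
  p123 p132 p213 p231 p312 p321 : Perm

act : Perm → ℤ³ → ℤ³
act p123 v = v
act p132 v = ⟨ x₁ v , x₃ v , x₂ v ⟩
act p213 v = ⟨ x₂ v , x₁ v , x₃ v ⟩
act p231 v = ⟨ x₂ v , x₃ v , x₁ v ⟩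
act p312 v = ⟨ x₃ v , x₁ v , x₂ v ⟩
act p321 v = ⟨ x₃ v , x₂ v , x₁ v ⟩

inv : Perm → Perm
inv p231 = p312
inv p312 = p231
inv σ    = σ

act-inv : ∀ σ v → act σ (act (inv σ) v) ≡ v
act-inv p123 v = refl
act-inv p132 v = refl
act-inv p213 v = refl
act-inv p231 v = refl
act-inv p312 v = refl
act-inv p321 v = refl

inv-act : ∀ σ v → act (inv σ) (act σ v) ≡ v
inv-act p123 v = refl
inv-act p132 v = refl
inv-act p213 v = refl
inv-act p231 v = refl
inv-act p312 v = refl
inv-act p321 v = refl

act-⊕ : ∀ σ a b → act σ (a ⊕ b) ≡ act σ a ⊕ act σ b
act-⊕ p123 a b = refl
act-⊕ p132 a b = refl
act-⊕ p213 a b = refl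
act-⊕ p231 a b = refl
act-⊕ p312 a b = refl
act-⊕ p321 a b = refl

act-⊖ : ∀ σ a b → act σ (a ⊖ b) ≡ act σ a ⊖ act σ b
act-⊖ p123 a b = refl
act-⊖ p132 a b = refl
act-⊖ p213 a b = refl
act-⊖ p231 a b = refl
act-⊖ p312 a b = refl
act-⊖ p321 a b = refl

act-neg : ∀ σ v → act σ (neg v) ≡ neg (act σ v)
act-neg p123 v = refl
act-neg p132 v = refl
act-neg p213 v = refl
act-neg p231 v = refl
act-neg p312 v = refl
act-neg p321 v = refl

act-c111 : ∀ σ → act σ c111 ≡ c111
act-c111 p123 = refl
act-c111 p132 = refl
act-c111 p213 = refl
act-c111 p231 = refl
act-c111 p312 = refl
act-c111 p321 = refl

act-nonneg : ∀ σ {v} → Nonneg v → Nonneg (act σ v)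
act-nonneg p123 (a , b , c) = a , b , c
act-nonneg p132 (a , b , c) = a , c , b
act-nonneg p213 (a , b , c) = b , a , c
act-nonneg p231 (a , b , c) = b , c , a
act-nonneg p312 (a , b , c) = c , a , b
act-nonneg p321 (a , b , c) = c , b , a

coordSum-act : ∀ σ v → coordSum (act σ v) ≡ coordSum v
coordSum-act p123 v = refl
coordSum-act p132 v = lemma (x₁ v) (x₂ v) (x₃ v)
  where lemma : ∀ a b c → a + c + b ≡ a + b + c
        lemma = solve-∀
coordSum-act p213 v = lemma (x₁ v) (x₂ v) (x₃ v)
  where lemma : ∀ a b c → b + a + c ≡ a + b + c
        lemma = solve-∀
coordSum-act p231 v = lemma (x₁ v) (x₂ v) (x₃ v)
  where lemma : ∀ a b c → b + c + a ≡ a + b + c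
        lemma = solve-∀
coordSum-act p312 v = lemma (x₁ v) (x₂ v) (x₃ v)
  where lemma : ∀ a b c → c + a + b ≡ a + b + c
        lemma = solve-∀
coordSum-act p321 v = lemma (x₁ v) (x₂ v) (x₃ v)
  where lemma : ∀ a b c → c + b + a ≡ a + b + c
        lemma = solve-∀

actΔ : ∀ {m} → Perm → ΔV m → ΔV m
actΔ σ a = toΔ (act σ (pt a)) (act-nonneg σ (Δ-nonneg a)) (trans (coordSum-act σ (pt a)) (Δ-sum a))

perms : List Perm
perms = p123 ∷ p132 ∷ p213 ∷ p231 ∷ p312 ∷ p321 ∷ []

perm∈perms : ∀ σ → σ ∈ perms
perm∈perms p123 = here refl
perm∈perms p132 = there (here refl)
perm∈perms p213 = there (there (here refl))
perm∈perms p231 = there (there (there (here refl)))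
perm∈perms p312 = there (there (there (there (here refl))))
perm∈perms p321 = there (there (there (there (there (here refl)))))

private
  act-directions : All (λ σ → All (λ d → act σ d ∈ directions) directions) perms
  act-directions = toWitness {a? = all? (λ σ → all? (λ d → act σ d ∈? directions) directions) perms} _

  act-units′ : All (λ σ → All (λ u → act σ u ∈ units) units) perms
  act-units′ = toWitness {a? = all? (λ σ → all? (λ u → act σ u ∈? units) units) perms} _

act-HexAdj : ∀ σ {x y} → HexAdj x y → HexAdj (act σ x) (act σ y)
act-HexAdj σ {x} {y} x~y =
  subst (_∈ directions) (act-⊖ σ x y) (All.lookup (All.lookup act-directions (perm∈perms σ)) x~y)

act-units : ∀ σ {u} → u ∈ units → act σ u ∈ units
act-units σ = All.lookup (All.lookup act-units′ (perm∈perms σ))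

data Orientation : Set where
  upright inverted : Orientation

orient : Orientation → ℤ³ → ℤ³
orient upright  v = v
orient inverted v = neg v

orient-⊕ : ∀ o a b → orient o (a ⊕ b) ≡ orient o a ⊕ orient o b
orient-⊕ upright  a b = refl
orient-⊕ inverted a b = neg-⊕ a b

act-orient : ∀ σ o v → act σ (orient o v) ≡ orient o (act σ v)
act-orient σ upright  v = refl
act-orient σ inverted v = act-neg σ v

-- Rigidity of embedded triangles

Additive : (ℤ³ → ℤ³) → Set
Additive L = ∀ a b → L (a ⊕ b) ≡ L a ⊕ L b

Affine : (ℤ³ → ℤ³) → Set
Affine H = ∀ {x y z w} → w ⊕ z ≡ x ⊕ y → H w ⊕ H z ≡ H x ⊕ H y

symmetry-additive : ∀ o σ → Additive (orient o ∘ act σ)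
symmetry-additive o σ a b = trans (cong (orient o) (act-⊕ σ a b)) (orient-⊕ o (act σ a) (act σ b))

translate-affine : ∀ T L → Additive L → Affine (λ p → T ⊕ L p)
translate-affine T L L-additive {x} {y} {z} {w} w+z≡x+y = begin
  (T ⊕ L w) ⊕ (T ⊕ L z) ≡⟨ ⊕-interchange T (L w) T (L z) ⟩
  (T ⊕ T) ⊕ (L w ⊕ L z) ≡⟨ cong ((T ⊕ T) ⊕_) (sym (L-additive w z)) ⟩
  (T ⊕ T) ⊕ L (w ⊕ z)   ≡⟨ cong (λ v → (T ⊕ T) ⊕ L v) w+z≡x+y ⟩
  (T ⊕ T) ⊕ L (x ⊕ y)   ≡⟨ cong ((T ⊕ T) ⊕_) (L-additive x y) ⟩
  (T ⊕ T) ⊕ (L x ⊕ L y) ≡⟨ ⊕-interchange T T (L x) (L y) ⟩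
  (T ⊕ L x) ⊕ (T ⊕ L y) ∎
  where open ≡-Reasoning

module Embedding {n : ℕ} (F : ΔV (suc n) → ℤ³)
  (F-injective : ∀ a b → F a ≡ F b → pt a ≡ pt b)
  (F-adjacent : ∀ a b → HexAdj (pt a) (pt b) → HexAdj (F a) (F b)) where

  F-rhombus : ∀ {a b c d} → Rhombus (pt a) (pt b) (pt c) (pt d) → Rhombus (F a) (F b) (F c) (F d)
  F-rhombus {a} {b} {c} {d} r = record
    { x~y = F-adjacent a b x~y ; z~x = F-adjacent c a z~x ; z~y = F-adjacent c b z~y
    ; w~x = F-adjacent d a w~x ; w~y = F-adjacent d b w~y ; z≢w = z≢w ∘ F-injective c d }
    where open Rhombus r

  module AffineAgreement (H : ℤ³ → ℤ³) (H-affine : Affine H)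
    (agree₀ : F apex ≡ H (pt (apex {n}))) (agree₁ : F apexNbr₁ ≡ H (pt (apexNbr₁ {n})))
    (agree₂ : F apexNbr₂ ≡ H (pt (apexNbr₂ {n}))) where

    Agrees : ΔV (suc n) → Set
    Agrees a = F a ≡ H (pt a)

    rhombus-agrees : ∀ {a b c d} → Rhombus (pt a) (pt b) (pt c) (pt d) →
                     Agrees a → Agrees b → Agrees c → Agrees d
    rhombus-agrees {a} {b} {c} {d} r agree-a agree-b agree-c = ⊕-cancelʳ (F d) (H (pt d)) (H (pt c)) (begin
      F d ⊕ H (pt c)           ≡⟨ cong (F d ⊕_) (sym agree-c) ⟩
      F d ⊕ F c                ≡⟨ rhombus-parallelogram (F-rhombus r) ⟩
      F a ⊕ F b                ≡⟨ cong₂ _⊕_ agree-a agree-b ⟩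
      H (pt a) ⊕ H (pt b)      ≡⟨ sym (H-affine (rhombus-parallelogram r)) ⟩
      H (pt d) ⊕ H (pt c)      ∎)
      where open ≡-Reasoning

    AgreesBelow : ℕ → Set
    AgreesBelow f = ∀ i j k e → i ℕ.+ j ℕ.≤ f → Agrees (vertex i j k e)

    -- The vertex (i+1, j+1, k) completes the rhombus on (i+1, j, k+1), (i, j+1, k+1), (i, j, k+2).
    interior : ∀ f → AgreesBelow f → ∀ i j k e → i ℕ.+ suc j ℕ.≤ f → Agrees (vertex (suc i) (suc j) k e)
    interior f below i j k e i+j+1≤f = rhombus-agrees {a} {b} {c} {vertex (suc i) (suc j) k e} (record
      { x~y = along ⟨ 1ℤ , -1ℤ , 0ℤ ⟩ (pt b) ; z~x = along ⟨ -1ℤ , 0ℤ , 1ℤ ⟩ (pt a)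
      ; z~y = along ⟨ 0ℤ , -1ℤ , 1ℤ ⟩ (pt b) ; w~x = along ⟨ 0ℤ , 1ℤ , -1ℤ ⟩ (pt a)
      ; w~y = along ⟨ 1ℤ , 0ℤ , -1ℤ ⟩ (pt b) ; z≢w = λ eq → ℕ.1+n≢n (sym (ℤ.+-injective (cong x₁ eq))) })
      (below (suc i) j (suc k) _ (subst (ℕ._≤ f) (ℕ.+-suc i j) i+j+1≤f))
      (below i (suc j) (suc k) _ i+j+1≤f)
      (below i j (suc (suc k)) _ (ℕ.≤-trans (ℕ.+-monoʳ-≤ i (ℕ.n≤1+n j)) i+j+1≤f))
      where
      a = vertex (suc i) j (suc k) (trans (shift₂₃ (suc i) j k) e)
      b = vertex i (suc j) (suc k) (trans (shift₁₃ i (suc j) k) e)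
      c = vertex i j (suc (suc k)) (trans (shift₂₃ i j (suc k)) (trans (shift₁₃ i (suc j) k) e))

    -- The edge vertex (i+2, 0, k) completes the rhombus on (i+1, 0, k+1), (i+1, 1, k), (i, 1, k+1),
    -- where (i+1, 1, k) lies on the same level but is interior.
    edge₁ : ∀ f → AgreesBelow f → ∀ i k e → suc i ℕ.+ 0 ℕ.≤ f → Agrees (vertex (suc (suc i)) 0 k e)
    edge₁ f below i k e i+1≤f = rhombus-agrees {a} {b} {c} {vertex (suc (suc i)) 0 k e} (record
      { x~y = along ⟨ 0ℤ , -1ℤ , 1ℤ ⟩ (pt b) ; z~x = along ⟨ -1ℤ , 1ℤ , 0ℤ ⟩ (pt a)
      ; z~y = along ⟨ -1ℤ , 0ℤ , 1ℤ ⟩ (pt b) ; w~x = along ⟨ 1ℤ , 0ℤ , -1ℤ ⟩ (pt a)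
      ; w~y = along ⟨ 1ℤ , -1ℤ , 0ℤ ⟩ (pt b) ; z≢w = λ eq → ℕ.1+n≢n (ℤ.+-injective (cong x₂ eq)) })
      (below (suc i) 0 (suc k) _ i+1≤f)
      (interior f below i 0 k _ i+1≤f′)
      (below i 1 (suc k) _ i+1≤f′)
      where
      a = vertex (suc i) 0 (suc k) (trans (shift₁₃ (suc i) 0 k) e)
      b = vertex (suc i) 1 k (trans (shift₁₂ (suc i) 0 k) e)
      c = vertex i 1 (suc k) (trans (shift₁₃ i 1 k) (trans (shift₁₂ (suc i) 0 k) e))
      i+1≤f′ : i ℕ.+ 1 ℕ.≤ f
      i+1≤f′ = subst (ℕ._≤ f) (sym (ℕ.+-suc i 0)) i+1≤f

    edge₂ : ∀ f → AgreesBelow f → ∀ j k e → suc j ℕ.≤ f → Agrees (vertex 0 (suc (suc j)) k e)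
    edge₂ f below j k e j+1≤f = rhombus-agrees {a} {b} {c} {vertex 0 (suc (suc j)) k e} (record
      { x~y = along ⟨ -1ℤ , 0ℤ , 1ℤ ⟩ (pt b) ; z~x = along ⟨ 1ℤ , -1ℤ , 0ℤ ⟩ (pt a)
      ; z~y = along ⟨ 0ℤ , -1ℤ , 1ℤ ⟩ (pt b) ; w~x = along ⟨ 0ℤ , 1ℤ , -1ℤ ⟩ (pt a)
      ; w~y = along ⟨ -1ℤ , 1ℤ , 0ℤ ⟩ (pt b) ; z≢w = λ eq → ℕ.1+n≢n (ℤ.+-injective (cong x₁ eq)) })
      (below 0 (suc j) (suc k) _ j+1≤f)
      (interior f below 0 j k _ j+1≤f)
      (below 1 j (suc k) _ j+1≤f)
      where
      a = vertex 0 (suc j) (suc k) (trans (shift₂₃ 0 (suc j) k) e)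
      b = vertex 1 (suc j) k (trans (sym (shift₁₂ 0 (suc j) k)) e)
      c = vertex 1 j (suc k) (trans (shift₂₃ 1 j k) (trans (sym (shift₁₂ 0 (suc j) k)) e))

    agrees-below : ∀ f → AgreesBelow f
    agrees-below _       0             0             _ refl _       = agree₀
    agrees-below _       1             0             _ refl _       = agree₁
    agrees-below _       0             1             _ refl _       = agree₂
    agrees-below (suc f) (suc i)       (suc j)       k e    (s≤s le) = interior f (agrees-below f) i j k e le
    agrees-below (suc f) (suc (suc i)) 0             k e    (s≤s le) = edge₁ f (agrees-below f) i k e le
    agrees-below (suc f) 0             (suc (suc j)) k e    (s≤s le) = edge₂ f (agrees-below f) j k e le

    agrees : ∀ a → F a ≡ H (pt a)
    agrees a with coordinatesOf a
    ... | coordinates i j k e = agrees-below (i ℕ.+ j) i j k e ℕ.≤-refl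

u₀ w₀ : ℤ³
u₀ = ⟨ 1ℤ , 0ℤ , -1ℤ ⟩
w₀ = ⟨ 0ℤ , 1ℤ , -1ℤ ⟩

symmetries : List (Orientation × Perm)
symmetries = cartesianProduct (upright ∷ inverted ∷ []) perms

ImageOf-u₀w₀ : ℤ³ → ℤ³ → Orientation × Perm → Set
ImageOf-u₀w₀ U W (o , σ) = U ≡ orient o (act σ u₀) × W ≡ orient o (act σ w₀)

private
  adjacent-directions :
    All (λ U → All (λ W → W ⊖ U ∈ directions → Any (ImageOf-u₀w₀ U W) symmetries) directions) directions
  adjacent-directions = toWitness {a? = all? (λ U → all? (λ W → (W ⊖ U ∈? directions) →-dec
    Any.any? (λ (o , σ) → (U ≟³ orient o (act σ u₀)) ×-dec (W ≟³ orient o (act σ w₀))) symmetries)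
    directions) directions} _

Placement : ∀ {n} → (ΔV n → ℤ³) → Set
Placement F = Σ Orientation λ o → Σ Perm λ σ → Σ ℤ³ λ T → ∀ a → F a ≡ T ⊕ orient o (act σ (pt a))

rigidity : ∀ {n} (F : ΔV (suc n) → ℤ³) → (∀ a b → F a ≡ F b → pt a ≡ pt b) →
  (∀ a b → HexAdj (pt a) (pt b) → HexAdj (F a) (F b)) → Placement F
rigidity {n} F F-injective F-adjacent =
  placement (Any.satisfied (All.lookup (All.lookup adjacent-directions U∈) W∈ W⊖U∈))
  where
  U W : ℤ³
  U = F apexNbr₁ ⊖ F apex
  W = F apexNbr₂ ⊖ F apex
  U∈ : U ∈ directions
  U∈ = F-adjacent apexNbr₁ apex (along u₀ (pt (apex {n})))
  W∈ : W ∈ directions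
  W∈ = F-adjacent apexNbr₂ apex (along w₀ (pt (apex {n})))
  W⊖U∈ : W ⊖ U ∈ directions
  W⊖U∈ = subst (_∈ directions) (sym ([a⊖c]⊖[b⊖c]≡a⊖b (F apexNbr₂) (F apexNbr₁) (F apex)))
    (F-adjacent apexNbr₂ apexNbr₁ (along ⟨ -1ℤ , 1ℤ , 0ℤ ⟩ (pt (apexNbr₁ {n}))))

  placement : ∃ (ImageOf-u₀w₀ U W) → Placement F
  placement ((o , σ) , U≡ , W≡) =
    o , σ , T , AffineAgreement.agrees (λ p → T ⊕ L p) (translate-affine T L L-additive)
                  agree₀ (agree-nbr U≡) (agree-nbr W≡)
    where
    open Embedding F F-injective F-adjacent
    L : ℤ³ → ℤ³
    L = orient o ∘ act σ
    L-additive : Additive L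
    L-additive = symmetry-additive o σ
    T : ℤ³
    T = F apex ⊖ L (pt (apex {n}))
    agree₀ : F apex ≡ T ⊕ L (pt (apex {n}))
    agree₀ = ⊖-⊕-cancel (F apex) (L (pt (apex {n})))
    agree-nbr : ∀ {b d} → F b ⊖ F apex ≡ L d → F b ≡ T ⊕ L (d ⊕ pt (apex {n}))
    agree-nbr {b} {d} eq = begin
      F b                                 ≡⟨ sym ([a⊖b]⊕[[c⊖a]⊕b]≡c (F apex) (L (pt (apex {n}))) (F b)) ⟩
      T ⊕ ((F b ⊖ F apex) ⊕ L (pt apex)) ≡⟨ cong (λ v → T ⊕ (v ⊕ L (pt (apex {n})))) eq ⟩
      T ⊕ (L d ⊕ L (pt apex))            ≡⟨ cong (T ⊕_) (sym (L-additive d (pt (apex {n})))) ⟩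
      T ⊕ L (d ⊕ pt (apex {n}))          ∎
      where open ≡-Reasoning

Δ₀-placement : (F : ΔV 0 → ℤ³) → ∀ a → F a ≡ F corner₃ ⊕ act p123 (pt a)
Δ₀-placement F a with coordinatesOf a
... | coordinates 0 0 0 refl = sym (⊕-identityʳ (F corner₃))

pulled-back : ∀ σ o T p → act (inv σ) (T ⊕ orient o (act σ p)) ≡ act (inv σ) T ⊕ orient o p
pulled-back σ o T p = begin
  act (inv σ) (T ⊕ orient o (act σ p))             ≡⟨ act-⊕ (inv σ) T _ ⟩
  act (inv σ) T ⊕ act (inv σ) (orient o (act σ p)) ≡⟨ cong (act (inv σ) T ⊕_) (act-orient (inv σ) o (act σ p)) ⟩
  act (inv σ) T ⊕ orient o (act (inv σ) (act σ p)) ≡⟨ cong (λ v → act (inv σ) T ⊕ orient o v) (inv-act σ p) ⟩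
  act (inv σ) T ⊕ orient o p                       ∎
  where open ≡-Reasoning

pulled-back-vertex : ∀ {n m} (φ : ΔV n → ΔV m) o σ T → (∀ a → pt (φ a) ≡ T ⊕ orient o (act σ (pt a))) →
                     ∀ a → Σ (ΔV m) λ v → pt v ≡ act (inv σ) T ⊕ orient o (pt a)
pulled-back-vertex φ o σ T placed a =
  actΔ (inv σ) (φ a) , trans (cong (act (inv σ)) (placed a)) (pulled-back σ o T (pt a))

corners-nonneg⇒nonneg : ∀ t {N} → Nonneg (t ⊕ ⟨ N , 0ℤ , 0ℤ ⟩) → Nonneg (t ⊕ ⟨ 0ℤ , N , 0ℤ ⟩) →
                        Nonneg (t ⊕ ⟨ 0ℤ , 0ℤ , N ⟩) → Nonneg t
corners-nonneg⇒nonneg t (_ , p₂ , p₃) (p₁ , _ , _) _ =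
  subst (0ℤ ℤ.≤_) (ℤ.+-identityʳ (x₁ t)) p₁ ,
  subst (0ℤ ℤ.≤_) (ℤ.+-identityʳ (x₂ t)) p₂ ,
  subst (0ℤ ℤ.≤_) (ℤ.+-identityʳ (x₃ t)) p₃

anticorners-nonneg⇒nonneg : ∀ t {N} → Nonneg (t ⊕ neg ⟨ N , 0ℤ , 0ℤ ⟩) → Nonneg (t ⊕ neg ⟨ 0ℤ , N , 0ℤ ⟩) →
                            Nonneg (t ⊕ neg ⟨ 0ℤ , 0ℤ , N ⟩) → Nonneg (t ⊕ neg ⟨ N , N , N ⟩)
anticorners-nonneg⇒nonneg t (p₁ , _ , _) (_ , p₂ , _) (_ , _ , p₃) = p₁ , p₂ , p₃

nonneg-sum-vanishes : ∀ {s n} → Nonneg s → coordSum s + + n ≡ 0ℤ → s ≡ ⟨ 0ℤ , 0ℤ , 0ℤ ⟩ × n ≡ 0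
nonneg-sum-vanishes {n = zero} (+≤+ {n = zero} _ , +≤+ {n = zero} _ , +≤+ {n = zero} _) _ = refl , refl
nonneg-sum-vanishes (+≤+ {n = suc _} _ , +≤+ _ , +≤+ _) ()
nonneg-sum-vanishes (+≤+ {n = zero} _ , +≤+ {n = suc _} _ , +≤+ _) ()
nonneg-sum-vanishes (+≤+ {n = zero} _ , +≤+ {n = zero} _ , +≤+ {n = suc _} _) ()
nonneg-sum-vanishes {n = suc _} (+≤+ {n = zero} _ , +≤+ {n = zero} _ , +≤+ {n = zero} _) ()

upright-offset-unit : ∀ {n} (φ : ΔV n → ΔV (suc n)) σ e → (∀ a → pt (φ a) ≡ e ⊕ act σ (pt a)) → e ∈ units
upright-offset-unit {n} φ σ e placed =
  subst (_∈ units) (act-inv σ e) (act-units σ (Δ₁-units (toΔ t t-nonneg t-sum)))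
  where
  t = act (inv σ) e
  corner-nonneg : ∀ c → Nonneg (t ⊕ pt c)
  corner-nonneg c = let v , pt-v = pulled-back-vertex φ upright σ e placed c in
    subst Nonneg pt-v (Δ-nonneg v)
  t-nonneg : Nonneg t
  t-nonneg = corners-nonneg⇒nonneg t (corner-nonneg corner₁) (corner-nonneg corner₂) (corner-nonneg corner₃)
  t-sum : coordSum t ≡ 1ℤ
  t-sum = let v , pt-v = pulled-back-vertex φ upright σ e placed corner₃ in ∙-cancelʳ (+ n) _ _
    (trans (sym (coordSum-⊕ t (pt (corner₃ {n})))) (trans (cong coordSum (sym pt-v)) (Δ-sum v)))

inverted-forces-∇₁ : ∀ {n} (φ : ΔV (suc n) → ΔV (suc (suc n))) σ C →
  (∀ a → pt (φ a) ≡ C ⊕ neg (act σ (pt a))) → n ≡ 0 × C ≡ c111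
inverted-forces-∇₁ {n} φ σ C placed = n≡0 , (begin
  C          ≡⟨ sym (act-inv σ C) ⟩
  act σ t    ≡⟨ cong (act σ) (trans (⊕-neg-cancel t N³) (cong (_⊕ N³) s≡0)) ⟩
  act σ N³   ≡⟨ cong (λ m → act σ ⟨ + suc m , + suc m , + suc m ⟩) n≡0 ⟩
  act σ c111 ≡⟨ act-c111 σ ⟩
  c111       ∎)
  where
  open ≡-Reasoning
  t N³ s : ℤ³
  t = act (inv σ) C
  N³ = ⟨ + suc n , + suc n , + suc n ⟩
  -- Each coordinate of s is nonnegative at one of the corners, yet coordSum s = -n.
  s = t ⊕ neg N³
  corner-nonneg : ∀ c → Nonneg (t ⊕ neg (pt c))
  corner-nonneg c = let v , pt-v = pulled-back-vertex φ inverted σ C placed c in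
    subst Nonneg pt-v (Δ-nonneg v)
  s-nonneg : Nonneg s
  s-nonneg = anticorners-nonneg⇒nonneg t (corner-nonneg corner₁) (corner-nonneg corner₂) (corner-nonneg corner₃)
  apex-level : coordSum t - (1ℤ + + n) ≡ 1ℤ + (1ℤ + + n)
  apex-level = let v , pt-v = pulled-back-vertex φ inverted σ C placed corner₃ in
    trans (sym (coordSum-⊕ t (neg (pt (corner₃ {suc n}))))) (trans (cong coordSum (sym pt-v)) (Δ-sum v))
  balance : ∀ S m → S - (1ℤ + m) ≡ 1ℤ + (1ℤ + m) →
            (S + (- (1ℤ + m) + - (1ℤ + m) + - (1ℤ + m))) + m ≡ 0ℤ
  balance S m h = begin
    (S + (- (1ℤ + m) + - (1ℤ + m) + - (1ℤ + m))) + m ≡⟨ regroup S m ⟩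
    (S - (1ℤ + m)) + (- (1ℤ + m) + - (1ℤ + m) + m)   ≡⟨ cong (_+ (- (1ℤ + m) + - (1ℤ + m) + m)) h ⟩
    (1ℤ + (1ℤ + m)) + (- (1ℤ + m) + - (1ℤ + m) + m)  ≡⟨ cancel m ⟩
    0ℤ                                               ∎
    where
    regroup : ∀ S m → (S + (- (1ℤ + m) + - (1ℤ + m) + - (1ℤ + m))) + m ≡
                      (S - (1ℤ + m)) + (- (1ℤ + m) + - (1ℤ + m) + m)
    regroup = solve-∀
    cancel : ∀ m → (1ℤ + (1ℤ + m)) + (- (1ℤ + m) + - (1ℤ + m) + m) ≡ 0ℤ
    cancel = solve-∀
  s-sum : coordSum s + + n ≡ 0ℤ
  s-sum = trans (cong (_+ + n) (coordSum-⊕ t (neg N³))) (balance (coordSum t) (+ n) apex-level)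
  s≡0 : s ≡ ⟨ 0ℤ , 0ℤ , 0ℤ ⟩
  s≡0 = proj₁ (nonneg-sum-vanishes s-nonneg s-sum)
  n≡0 : n ≡ 0
  n≡0 = proj₂ (nonneg-sum-vanishes s-nonneg s-sum)

image-adjacent : ∀ {n m} {S : Subgraph m} (iso : IsoFromΔ n S) → ∀ a b →
  HexAdj (pt a) (pt b) → HexAdj (pt (IsoFromΔ.φ iso a)) (pt (IsoFromΔ.φ iso b))
image-adjacent {S = S} iso a b a~b = proj₂ (proj₂ (E-sub S _ _ (proj₁ (IsoFromΔ.edges iso a b) a~b)))

module Translated {n} {S : Subgraph (suc n)} (iso : IsoFromΔ n S) σ e
  (placed : ∀ a → pt (IsoFromΔ.φ iso a) ≡ e ⊕ act σ (pt a)) where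
  open IsoFromΔ iso

  shifted : ∀ a → pt (actΔ σ a) ⊕ e ≡ pt (φ a)
  shifted a = trans (⊕-comm _ e) (sym (placed a))

  unshifted : ∀ a v → pt a ⊕ e ≡ pt v → φ (actΔ (inv σ) a) ≡ v
  unshifted a v eq = pt-injective (begin
    pt (φ (actΔ (inv σ) a))      ≡⟨ placed _ ⟩
    e ⊕ act σ (act (inv σ) (pt a)) ≡⟨ cong (e ⊕_) (act-inv σ (pt a)) ⟩
    e ⊕ pt a                     ≡⟨ ⊕-comm e (pt a) ⟩
    pt a ⊕ e                     ≡⟨ eq ⟩
    pt v                         ∎)
    where open ≡-Reasoning

  vertices : ∀ v → V S v ⇔ ∃ λ (a : ΔV n) → pt a ⊕ e ≡ pt v
  vertices v = to , from
    where
    to : V S v → ∃ λ a → pt a ⊕ e ≡ pt v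
    to v∈S = let a , φa≡v = onto v v∈S in actΔ σ a , trans (shifted a) φa≡v
    from : (∃ λ a → pt a ⊕ e ≡ pt v) → V S v
    from (a , eq) = subst (V S) (unshifted a v eq) (into _)

  ShiftedEdge : ΔV (suc n) → ΔV (suc n) → Set
  ShiftedEdge u v =
    Σ (ΔV n) λ a → Σ (ΔV n) λ b → HexAdj (pt a) (pt b) × (pt a ⊕ e ≡ pt u) × (pt b ⊕ e ≡ pt v)

  edges′ : ∀ u v → E S u v ⇔ ShiftedEdge u v
  edges′ u v = to , from
    where
    to : E S u v → ShiftedEdge u v
    to uv∈S with E-sub S u v uv∈S
    ... | u∈S , v∈S , _ with onto u u∈S | onto v v∈S
    ... | a , φa≡u | b , φb≡v =
      actΔ σ a , actΔ σ b , act-HexAdj σ a~b , trans (shifted a) φa≡u , trans (shifted b) φb≡v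
      where
      a~b : HexAdj (pt a) (pt b)
      a~b = proj₂ (edges a b) (subst₂ (E S) (sym (pt-injective φa≡u)) (sym (pt-injective φb≡v)) uv∈S)
    from : ShiftedEdge u v → E S u v
    from (a , b , a~b , eqa , eqb) =
      subst₂ (E S) (unshifted a u eqa) (unshifted b v eqb) (proj₁ (edges _ _) (act-HexAdj (inv σ) a~b))

  isTranslate : IsTranslate n S e
  isTranslate = vertices , edges′

∇₁-reflected-unit : ∀ {t} → t ∈ nabla₁ → ∃ λ u → u ∈ units × t ≡ c111 ⊕ neg u
∇₁-reflected-unit (here refl)                 = _ , there (there (here refl)) , refl
∇₁-reflected-unit (there (here refl))         = _ , here refl , refl
∇₁-reflected-unit (there (there (here refl))) = _ , there (here refl) , refl

reflected-unit-∈∇₁ : ∀ {u} → u ∈ units → c111 ⊕ neg u ∈ nabla₁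
reflected-unit-∈∇₁ (here refl)                 = there (here refl)
reflected-unit-∈∇₁ (there (here refl))         = there (there (here refl))
reflected-unit-∈∇₁ (there (there (here refl))) = here refl

unit-vertex : ∀ {u} → u ∈ units → Σ (ΔV 1) λ a → pt a ≡ u
unit-vertex (here refl)                 = vertex 1 0 0 refl , refl
unit-vertex (there (here refl))         = vertex 0 1 0 refl , refl
unit-vertex (there (there (here refl))) = vertex 0 0 1 refl , refl

private
  units-adjacent′ : All (λ u → All (λ u′ → u ≢ u′ → HexAdj u u′) units) units
  units-adjacent′ =
    toWitness {a? = all? (λ u → all? (λ u′ → ¬? (u ≟³ u′) →-dec (u ⊖ u′ ∈? directions)) units) units} _

units-adjacent : ∀ {u u′} → u ∈ units → u′ ∈ units → u ≢ u′ → HexAdj u u′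
units-adjacent u∈ u′∈ = All.lookup (All.lookup units-adjacent′ u∈) u′∈

module Reflected {S : Subgraph 2} (iso : IsoFromΔ 1 S) σ
  (placed : ∀ a → pt (IsoFromΔ.φ iso a) ≡ c111 ⊕ neg (act σ (pt a))) where
  open IsoFromΔ iso

  image-∈∇₁ : ∀ a → pt (φ a) ∈ nabla₁
  image-∈∇₁ a = subst (_∈ nabla₁) (sym (placed a)) (reflected-unit-∈∇₁ (act-units σ (Δ₁-units a)))

  preimage : ∀ v → pt v ∈ nabla₁ → Σ (ΔV 1) λ a → φ a ≡ v
  preimage v v∈∇ with ∇₁-reflected-unit v∈∇
  ... | u , u∈ , v≡ with unit-vertex (act-units (inv σ) u∈)
  ... | a , a≡ = a , pt-injective (begin
    pt (φ a)                           ≡⟨ placed a ⟩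
    c111 ⊕ neg (act σ (pt a))          ≡⟨ cong (λ w → c111 ⊕ neg (act σ w)) a≡ ⟩
    c111 ⊕ neg (act σ (act (inv σ) u)) ≡⟨ cong (λ w → c111 ⊕ neg w) (act-inv σ u) ⟩
    c111 ⊕ neg u                       ≡⟨ sym v≡ ⟩
    pt v                               ∎)
    where open ≡-Reasoning

  vertices : ∀ v → V S v ⇔ (pt v ∈ nabla₁)
  vertices v = (λ v∈S → let a , φa≡v = onto v v∈S in subst (_∈ nabla₁) φa≡v (image-∈∇₁ a))
             , (λ v∈∇ → let a , φa≡v = preimage v v∈∇ in subst (V S) φa≡v (into a))

  distinct-preimages : ∀ {u v} a b → φ a ≡ u → φ b ≡ v → HexAdj (pt u) (pt v) → pt a ≢ pt b
  distinct-preimages a b refl refl φa~φb a≡b with pt-injective {a = a} {b} a≡b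
  ... | refl = ¬HexAdj-refl (pt (φ a)) φa~φb

  edges′ : ∀ u v → E S u v ⇔ ((pt u ∈ nabla₁) × (pt v ∈ nabla₁) × HexAdj (pt u) (pt v))
  edges′ u v = to , from
    where
    to : E S u v → (pt u ∈ nabla₁) × (pt v ∈ nabla₁) × HexAdj (pt u) (pt v)
    to uv∈S = let u∈S , v∈S , u~v = E-sub S u v uv∈S in
      proj₁ (vertices u) u∈S , proj₁ (vertices v) v∈S , u~v
    from : (pt u ∈ nabla₁) × (pt v ∈ nabla₁) × HexAdj (pt u) (pt v) → E S u v
    from (u∈∇ , v∈∇ , u~v) =
      let a , φa≡u = preimage u u∈∇ ; b , φb≡v = preimage v v∈∇ in
      subst₂ (E S) φa≡u φb≡v (proj₁ (edges a b)
        (units-adjacent (Δ₁-units a) (Δ₁-units b) (distinct-preimages a b φa≡u φb≡v u~v)))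

  isNabla₁ : IsNabla₁ S
  isNabla₁ = vertices , edges′

record Dominated {m} (P : ΔV m → Set) (v : ΔV m) : Set where
  constructor dominated
  field
    u   : ΔV m
    P-u : P u
    u≈v : (pt u ≡ pt v) ⊎ HexAdj (pt u) (pt v)

ShiftOf : ∀ {n} → ℤ³ → ΔV (suc n) → Set
ShiftOf {n} e u = ∃ λ (a : ΔV n) → pt a ⊕ e ≡ pt u

e₁ : ℤ³
e₁ = ⟨ 1ℤ , 0ℤ , 0ℤ ⟩

-- Stated with e₁ ⊕ pt a, which reduces to the coordinates of the shifted vertex.
e₁-shift : ∀ {n} (a : ΔV n) → ∃ λ (a′ : ΔV n) → pt a′ ⊕ e₁ ≡ e₁ ⊕ pt a
e₁-shift a = a , ⊕-comm (pt a) e₁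

e₁-shift-dominates : ∀ {n} (v : ΔV (suc n)) → Dominated (ShiftOf e₁) v
e₁-shift-dominates v with coordinatesOf v
... | coordinates (suc i) j k e = dominated (vertex (suc i) j k e) (e₁-shift (vertex i j k (ℕ.suc-injective e)))
  (inj₁ refl)
... | coordinates 0 (suc j) k e = dominated (vertex 1 j k e) (e₁-shift (vertex 0 j k (ℕ.suc-injective e)))
  (inj₂ (along ⟨ 1ℤ , -1ℤ , 0ℤ ⟩ ⟨ + 0 , + suc j , + k ⟩))
... | coordinates 0 0 (suc k) e = dominated (vertex 1 0 k e) (e₁-shift (vertex 0 0 k (ℕ.suc-injective e)))
  (inj₂ (along ⟨ 1ℤ , 0ℤ , -1ℤ ⟩ ⟨ + 0 , + 0 , + suc k ⟩))

unit-as-image-of-e₁ : ∀ {e} → e ∈ units → ∃ λ σ → e ≡ act σ e₁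
unit-as-image-of-e₁ (here refl)                 = p123 , refl
unit-as-image-of-e₁ (there (here refl))         = p213 , refl
unit-as-image-of-e₁ (there (there (here refl))) = p321 , refl

shift-dominates : ∀ {n e} → e ∈ units → (v : ΔV (suc n)) → Dominated (ShiftOf e) v
shift-dominates {n} e∈ v with unit-as-image-of-e₁ e∈
... | σ , refl with e₁-shift-dominates (actΔ (inv σ) v)
... | dominated u (a , a+e₁≡u) u≈v = dominated (actΔ σ u) (actΔ σ a , a+e≡u) (Sum.map moved moved-adjacent u≈v)
  where
  a+e≡u : act σ (pt a) ⊕ act σ e₁ ≡ act σ (pt u)
  a+e≡u = trans (sym (act-⊕ σ (pt a) e₁)) (cong (act σ) a+e₁≡u)
  moved : pt u ≡ act (inv σ) (pt v) → act σ (pt u) ≡ pt v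
  moved eq = trans (cong (act σ) eq) (act-inv σ (pt v))
  moved-adjacent : HexAdj (pt u) (act (inv σ) (pt v)) → HexAdj (act σ (pt u)) (pt v)
  moved-adjacent = subst (HexAdj (act σ (pt u))) (act-inv σ (pt v)) ∘ act-HexAdj σ

translate-nbhd : ∀ {n} (S : Subgraph (suc n)) {e} → e ∈ units → IsTranslate n S e → InClosedNbhd S
translate-nbhd S e∈ (vertices , _) v =
  let dominated u shift u≈v = shift-dominates e∈ v in u , proj₂ (vertices u) shift , u≈v

∇₁-nbhd : ∀ (S : Subgraph 2) → IsNabla₁ S → InClosedNbhd S
∇₁-nbhd S (vertices , _) v with coordinatesOf v
... | coordinates 1 1 _ refl = v , proj₂ (vertices v) (here refl) , inj₁ refl
... | coordinates 0 1 _ refl = v , proj₂ (vertices v) (there (here refl)) , inj₁ refl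
... | coordinates 1 0 _ refl = v , proj₂ (vertices v) (there (there (here refl))) , inj₁ refl
... | coordinates 2 0 _ refl =
  vertex 1 1 0 refl , proj₂ (vertices _) (here refl) , inj₂ (along ⟨ -1ℤ , 1ℤ , 0ℤ ⟩ (pt v))
... | coordinates 0 2 _ refl =
  vertex 1 1 0 refl , proj₂ (vertices _) (here refl) , inj₂ (along ⟨ 1ℤ , -1ℤ , 0ℤ ⟩ (pt v))
... | coordinates 0 0 _ refl =
  vertex 1 0 1 refl , proj₂ (vertices _) (there (there (here refl))) , inj₂ (along ⟨ 1ℤ , 0ℤ , -1ℤ ⟩ (pt v))
... | coordinates 0 (suc (suc (suc _))) _ ()
... | coordinates 1 (suc (suc _)) _ ()
... | coordinates 2 (suc _) _ ()
... | coordinates (suc (suc (suc _))) _ _ ()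

Conclusion : ∀ n → Subgraph (suc n) → Set
Conclusion n S = ((Σ _ (λ e → (e ∈ units) × IsTranslate n S e)) ⊎ ((suc n ≡ 2) × IsNabla₁ S)) × InClosedNbhd S

translated : ∀ {n} {S : Subgraph (suc n)} (iso : IsoFromΔ n S) σ e →
             (∀ a → pt (IsoFromΔ.φ iso a) ≡ e ⊕ act σ (pt a)) → Conclusion n S
translated {S = S} iso σ e placed = inj₁ (e , e∈ , translate) , translate-nbhd S e∈ translate
  where
  translate = Translated.isTranslate iso σ e placed
  e∈ = upright-offset-unit (IsoFromΔ.φ iso) σ e placed

reflected : ∀ {n} {S : Subgraph (suc (suc n))} (iso : IsoFromΔ (suc n) S) σ C → n ≡ 0 → C ≡ c111 →
            (∀ a → pt (IsoFromΔ.φ iso a) ≡ C ⊕ neg (act σ (pt a))) → Conclusion (suc n) S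
reflected {S = S} iso σ _ refl refl placed = inj₂ (refl , nabla) , ∇₁-nbhd S nabla
  where nabla = Reflected.isNabla₁ iso σ placed

mainTheorem9 : ∀ (n : ℕ) (S : Subgraph (suc n)) → IsoFromΔ n S →
    ((Σ _ (λ e → (e ∈ units) × IsTranslate n S e)) ⊎ ((suc n ≡ 2) × IsNabla₁ S))
    × InClosedNbhd S
mainTheorem9 zero S iso = translated iso p123 (pt (φ corner₃)) (Δ₀-placement (pt ∘ φ))
  where open IsoFromΔ iso
mainTheorem9 (suc n) S iso = by-placement (rigidity (pt ∘ φ) inj (image-adjacent iso))
  where
  open IsoFromΔ iso
  by-placement : Placement (pt ∘ φ) → Conclusion (suc n) S
  by-placement (upright  , σ , e , placed) = translated iso σ e placed
  by-placement (inverted , σ , C , placed) =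
    let n≡0 , C≡c111 = inverted-forces-∇₁ φ σ C placed in reflected iso σ C n≡0 C≡c111 placed
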